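{- Let $C$ be a positive rational number and $1\le i\le h$ integers. Let $G$ be a regular commutative graph of ratio $C$ with layers $V_0,\dots,V_h$, $V_0\neq\emptyset$. Then $$D_i(G)=C^i\quad\text{and}\quad |V_i|=C^i|V_0|.$$ Furthermore, the inverse of $G$ is a regular commutative graph of ratio $C^{ -1}$.
   Context: A directed layered graph $G$ of level $h$ has vertex set $V_0\cup\dots\cup V_h$, a disjoint union of finite sets, with every directed edge going from some $V_i$ to $V_{i+1}$. For a vertex $x$, $\operatorname{im}(x)$, $\operatorname{im}^{ -1}(x)$ denote its out- and in-neighbourhoods; $\operatorname{im}^{(i)}(Z)$ is the set of vertices reachable from $Z$ by a directed path with $i$ edges. $G$ is commutative if: (upward) for every edge $uv$ there is an injective $\varphi:\operatorname{im}(v)\to\operatorname{im}(u)$ with $\varphi(x)x\in E(G)$ for all $x$; and (downward) for every edge $vw$ there is an injective $\psi:\operatorname{im}^{ -1}(v)\to\operatorname{im}^{ -1}(w)$ with $x\psi(x)\in E(G)$ for all $x$. $D_i(G)=\min_{\emptyset\neq Z\subseteq V_0}|\operatorname{im}^{(i)}(Z)|/|Z|$. A commutative graph is regular of ratio $C$ if there is a positive integer $d$ such that every vertex not in the bottom layer has in-degree $d$ and every vertex not in the top layer has out-degree $Cd$. The inverse of $G$ is the layered graph whose layers are $V_h,V_{h-1},\dots,V_0$ (in this order, bottom to top) and in which $uv$ is an edge iff $vu\in E(G)$. -}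

module Defs where

open import Data.Nat as ℕ using (ℕ; zero; suc; _∸_)
open import Data.Integer using (+_)
open import Data.Bool using (Bool; true; false; T; _∧_)
open import Data.Fin using (Fin; zero; suc)
open import Data.Vec using (_∷_; there)
open import Data.Fin.Subset using (Subset; ∣_∣; _∈_; _⊆_; Nonempty)
open import Data.List using (allFin)
open import Data.Bool.ListAction using (any)
open import Data.Vec using (tabulate; lookup)
open import Data.Product using (Σ; ∃; _×_; proj₁; _,_)
open import Data.Rational as ℚ using (ℚ; 1ℚ; _*_; _/_)
open import Relation.Binary.PropositionalEquality using (_≡_; _≢_)
open import Function using (flip)

-- A finite directed graph: vertex set Fin N, each vertex carries a level
-- (the index j of the layer V_j containing it), decidable edge relation.
record Graph : Set where
  field
    N     : ℕ
    level : Fin N → ℕ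
    E     : Fin N → Fin N → Bool

module _ (G : Graph) where
  open Graph G

  Edge : Fin N → Fin N → Set
  Edge u v = T (E u v)

  IsLayered : ℕ → Set
  IsLayered h = (∀ v → level v ℕ.≤ h) × (∀ u v → Edge u v → level v ≡ suc (level u))

  layer : ℕ → Subset N
  layer j = tabulate (λ v → ⌊ level v ≟ j ⌋)
    where open import Data.Nat using (_≟_)
          open import Relation.Nullary.Decidable using (⌊_⌋)

  im : Fin N → Subset N
  im u = tabulate (λ v → E u v)

  im⁻¹ : Fin N → Subset N
  im⁻¹ v = tabulate (λ u → E u v)

  outdeg indeg : Fin N → ℕ
  outdeg u = ∣ im u ∣
  indeg v = ∣ im⁻¹ v ∣

  imⁱ : ℕ → Subset N → Subset N
  imⁱ zero    Z = Z
  imⁱ (suc i) Z = tabulate (λ y → any (λ x → lookup (imⁱ i Z) x ∧ E x y) (allFin N))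

  Out In : Fin N → Set
  Out v = Σ (Fin N) (λ x → Edge v x)
  In  v = Σ (Fin N) (λ x → Edge x v)

  IsCommutative : Set
  IsCommutative =
    (∀ u v → Edge u v → Σ (Out v → Out u) λ φ →
        (∀ a b → proj₁ (φ a) ≡ proj₁ (φ b) → proj₁ a ≡ proj₁ b)
      × (∀ a → Edge (proj₁ (φ a)) (proj₁ a)))
    × (∀ v w → Edge v w → Σ (In v → In w) λ ψ →
        (∀ a b → proj₁ (ψ a) ≡ proj₁ (ψ b) → proj₁ a ≡ proj₁ b)
      × (∀ a → Edge (proj₁ a) (proj₁ (ψ a))))

nonempty⇒nonZero : ∀ {n} (Z : Subset n) → Nonempty Z → ℕ.NonZero ∣ Z ∣
nonempty⇒nonZero (true ∷ Z) _ = _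
nonempty⇒nonZero (false ∷ Z) (zero , ())
nonempty⇒nonZero (false ∷ Z) (suc x , there x∈) = nonempty⇒nonZero Z (x , x∈)

toℚ : ℕ → ℚ
toℚ n = (+ n) / 1

infixr 8 _^ℚ_
_^ℚ_ : ℚ → ℕ → ℚ
q ^ℚ zero  = 1ℚ
q ^ℚ suc n = q * (q ^ℚ n)

module _ (G : Graph) (h : ℕ) where
  open Graph G

  IsRegular : ℚ → Set
  IsRegular C = ∃ λ (d : ℕ) → (1 ℕ.≤ d)
    × (∀ v → level v ≢ 0 → indeg G v ≡ d)
    × (∀ v → level v ≢ h → toℚ (outdeg G v) ≡ C * toℚ d)

  -- D_i(G) = q : q is the minimum over nonempty Z ⊆ V_0 of |im^(i)(Z)| / |Z|
  D≡ : ℕ → ℚ → Set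
  D≡ i q =
    (∀ (Z : Subset N) → Z ⊆ layer G 0 → (ne : Nonempty Z) →
        q ℚ.≤ ((+ ∣ imⁱ G i Z ∣) / ∣ Z ∣) {{nonempty⇒nonZero Z ne}})
    × ∃ λ (Z : Subset N) → Z ⊆ layer G 0 × Σ (Nonempty Z) λ ne →
        q ≡ ((+ ∣ imⁱ G i Z ∣) / ∣ Z ∣) {{nonempty⇒nonZero Z ne}}

  inverse : Graph
  inverse = record { N = N ; level = λ v → h ∸ level v ; E = flip E }

-- Double count the edges from a set W ⊆ V_j to its image in V_{j+1}: each vertex of W
-- sends c = C·d edges there and each vertex of the image receives at most d, so the
-- image has at least C·|W| elements; iterating gives D_i ≥ C^i. For W = V_j both bounds
-- are equalities, and as every vertex above V_0 has an in-neighbour, im^(i)(V_0) = V_i;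
-- so |V_i| = C^i |V_0| and V_0 attains the minimum.

module Submission where

open import Defs
open import Algebra.Bundles using (CommutativeRing)
import Algebra.Properties.CommutativeSemigroup as CommSemigroupProperties
open import Data.Bool using (Bool; true; false; T; _∧_)
open import Data.Bool.Properties using (T-≡; T-∧)
open import Data.Empty using (⊥-elim)
open import Data.Fin using (Fin; zero; suc)
open import Data.Fin.Subset using (Subset; ∣_∣; _∈_; _⊆_; Nonempty)
open import Data.Fin.Subset.Properties using (nonempty?; Empty-unique; ∣⊥∣≡0; ⊆-antisym)
open import Data.Integer as ℤ using (+_)
import Data.Integer.Properties as ℤ
open import Data.List using (allFin)
open import Data.List.Membership.Propositional using (lose)
open import Data.List.Membership.Propositional.Properties using (∈-allFin)
open import Data.List.Relation.Unary.Any using (satisfied)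
open import Data.List.Relation.Unary.Any.Properties using (any⁺; any⁻)
open import Data.Nat as ℕ using (ℕ; zero; suc; _≤_; _<_; _^_; _∸_; z≤n; s≤s; NonZero)
open import Data.Nat.Properties as ℕ
  using (≤-refl; ≤-trans; ≤-reflexive; ≤-antisym; +-mono-≤; +-monoˡ-≤; *-monoˡ-≤;
         <-≤-trans; <⇒≢; n<1+n; 1+n≢0; suc-injective; n∸n≡0; m∸n≤m; m^n≢0; +-*-semiring)
open import Data.Product using (∃; _×_; _,_; proj₁; proj₂)
open import Data.Rational as ℚ using (ℚ; _/_; 1ℚ; Positive; 1/_)
open import Data.Rational.Properties as ℚ
  using (toℚᵘ-injective; toℚᵘ-fromℚᵘ; toℚᵘ-homo-*; toℚᵘ-cong; toℚᵘ-cancel-≤; fromℚᵘ-cong;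
         normalize-pos; *-cancelʳ-≤-pos; *-inverseˡ; *-identityˡ; pos⇒nonZero; pos*pos⇒pos;
         positive⁻¹)
import Data.Rational.Unnormalised as ℚᵘ
import Data.Rational.Unnormalised.Properties as ℚᵘ
open import Data.Vec using ([]; _∷_; lookup; tabulate)
open import Data.Vec.Properties using ([]=⇒lookup; lookup⇒[]=; lookup∘tabulate)
open import Function using (_∘_; id; flip; Equivalence)
open import Level using (0ℓ)
open import Relation.Binary using (Rel; Reflexive; Transitive)
open import Relation.Binary.PropositionalEquality
open import Relation.Nullary using (yes; no; contradiction)
open import Relation.Nullary.Decidable using (toWitness; fromWitness)

open import Algebra.Properties.Semiring.Sum +-*-semiring
  using (sum; sum-syntax; sum-cong-≗; ∑-comm; *-distribˡ-sum; *-distribʳ-sum)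
open Equivalence using (to; from)

module _ where

  open import Data.Nat using (_*_)

  χ : Bool → ℕ
  χ true  = 1
  χ false = 0

  ∑-mono-≤ : ∀ {n} {f g : Fin n → ℕ} → (∀ x → f x ≤ g x) → sum f ≤ sum g
  ∑-mono-≤ {zero}  _   = ≤-refl
  ∑-mono-≤ {suc n} f≤g = +-mono-≤ (f≤g zero) (∑-mono-≤ (f≤g ∘ suc))

  ∣p∣≡∑χ : ∀ {n} (p : Subset n) → ∣ p ∣ ≡ ∑[ x < n ] χ (lookup p x)
  ∣p∣≡∑χ []          = refl
  ∣p∣≡∑χ (true ∷ p)  = cong suc (∣p∣≡∑χ p)
  ∣p∣≡∑χ (false ∷ p) = ∣p∣≡∑χ p

  ∣p∣*k≡∑χ* : ∀ {n} (p : Subset n) k → ∣ p ∣ * k ≡ ∑[ x < n ] (χ (lookup p x) * k)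
  ∣p∣*k≡∑χ* p k = trans (cong (_* k) (∣p∣≡∑χ p)) (*-distribʳ-sum k (χ ∘ lookup p))

  χ*∣tabulate∣≡∑χ*χ : ∀ {n} b (f : Fin n → Bool) →
                      χ b * ∣ tabulate f ∣ ≡ ∑[ x < n ] (χ b * χ (f x))
  χ*∣tabulate∣≡∑χ*χ b f = begin
    χ b * ∣ tabulate f ∣                   ≡⟨ cong (χ b *_) (∣p∣≡∑χ (tabulate f)) ⟩
    χ b * ∑[ x < _ ] χ (lookup (tabulate f) x) ≡⟨ cong (χ b *_) (sum-cong-≗ (cong χ ∘ lookup∘tabulate f)) ⟩
    χ b * ∑[ x < _ ] χ (f x)               ≡⟨ *-distribˡ-sum (χ b) (χ ∘ f) ⟩
    ∑[ x < _ ] (χ b * χ (f x))             ∎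
    where open ≡-Reasoning

  χ*-monoʳ-≤ : ∀ b {m n} → (T b → m ≤ n) → χ b * m ≤ χ b * n
  χ*-monoʳ-≤ true  m≤n = +-monoˡ-≤ 0 (m≤n _)
  χ*-monoʳ-≤ false _   = ≤-refl

  χ*χ-≤ : ∀ a b c → (T a → T b → T c) → χ a * χ b ≤ χ c * χ b
  χ*χ-≤ false _     _     _    = z≤n
  χ*χ-≤ true  false _     _    = z≤n
  χ*χ-≤ true  true  true  _    = ≤-refl
  χ*χ-≤ true  true  false a→c = ⊥-elim (a→c _ _)

  module _ {n} {p : Subset n} {x : Fin n} where

    ∈⇒T-lookup : x ∈ p → T (lookup p x)
    ∈⇒T-lookup x∈p = from T-≡ ([]=⇒lookup x∈p)

    T-lookup⇒∈ : T (lookup p x) → x ∈ p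
    T-lookup⇒∈ t = lookup⇒[]= x p (to T-≡ t)

  module _ {n} {f : Fin n → Bool} {x : Fin n} where

    ∈-tabulate⁻ : x ∈ tabulate f → T (f x)
    ∈-tabulate⁻ = subst T (lookup∘tabulate f x) ∘ ∈⇒T-lookup

    ∈-tabulate⁺ : T (f x) → x ∈ tabulate f
    ∈-tabulate⁺ = T-lookup⇒∈ ∘ subst T (sym (lookup∘tabulate f x))

  ∣p∣≢0⇒nonempty : ∀ {n} (p : Subset n) → ∣ p ∣ ≢ 0 → Nonempty p
  ∣p∣≢0⇒nonempty {n} p ∣p∣≢0 with nonempty? p
  ... | yes p≢∅ = p≢∅
  ... | no  p≡∅ = contradiction (trans (cong ∣_∣ (Empty-unique p≡∅)) (∣⊥∣≡0 n)) ∣p∣≢0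

  -- Double counting the edges of a bipartite relation

  module DoubleCounting {m n} (e : Fin m → Fin n → Bool) where

    outdegree : Fin m → ℕ
    outdegree u = ∣ tabulate (e u) ∣

    indegree : Fin n → ℕ
    indegree v = ∣ tabulate (λ u → e u v) ∣

    double-count-≤ : ∀ (A : Subset m) (B : Subset n) {c d} →
                     (∀ {u v} → u ∈ A → T (e u v) → v ∈ B) →
                     (∀ {u} → u ∈ A → c ≤ outdegree u) →
                     (∀ {v} → v ∈ B → indegree v ≤ d) →
                     ∣ A ∣ * c ≤ ∣ B ∣ * d
    double-count-≤ A B {c} {d} A⇒B c≤out in≤d = begin
      ∣ A ∣ * c
        ≡⟨ ∣p∣*k≡∑χ* A c ⟩
      ∑[ u < m ] (χ (lookup A u) * c)
        ≤⟨ ∑-mono-≤ (λ u → χ*-monoʳ-≤ (lookup A u) (c≤out ∘ T-lookup⇒∈)) ⟩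
      ∑[ u < m ] (χ (lookup A u) * outdegree u)
        ≡⟨ sum-cong-≗ (λ u → χ*∣tabulate∣≡∑χ*χ (lookup A u) (e u)) ⟩
      ∑[ u < m ] ∑[ v < n ] (χ (lookup A u) * χ (e u v))
        ≤⟨ ∑-mono-≤ (λ u → ∑-mono-≤ (λ v → χ*χ-≤ (lookup A u) (e u v) (lookup B v)
                                            (λ u∈A e-uv → ∈⇒T-lookup (A⇒B (T-lookup⇒∈ u∈A) e-uv)))) ⟩
      ∑[ u < m ] ∑[ v < n ] (χ (lookup B v) * χ (e u v))
        ≡⟨ ∑-comm (λ u v → χ (lookup B v) * χ (e u v)) ⟩
      ∑[ v < n ] ∑[ u < m ] (χ (lookup B v) * χ (e u v))
        ≡⟨ sum-cong-≗ (λ v → χ*∣tabulate∣≡∑χ*χ (lookup B v) (λ u → e u v)) ⟨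
      ∑[ v < n ] (χ (lookup B v) * indegree v)
        ≤⟨ ∑-mono-≤ (λ v → χ*-monoʳ-≤ (lookup B v) (in≤d ∘ T-lookup⇒∈)) ⟩
      ∑[ v < n ] (χ (lookup B v) * d)
        ≡⟨ ∣p∣*k≡∑χ* B d ⟨
      ∣ B ∣ * d ∎
      where open ℕ.≤-Reasoning

  open DoubleCounting using (double-count-≤)

  double-count-≡ : ∀ {m n} (e : Fin m → Fin n → Bool) (A : Subset m) (B : Subset n) {c d} →
                   (∀ {u v} → u ∈ A → T (e u v) → v ∈ B) →
                   (∀ {u v} → v ∈ B → T (e u v) → u ∈ A) →
                   (∀ {u} → u ∈ A → DoubleCounting.outdegree e u ≡ c) →
                   (∀ {v} → v ∈ B → DoubleCounting.indegree e v ≡ d) →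
                   ∣ A ∣ * c ≡ ∣ B ∣ * d
  double-count-≡ e A B A⇒B B⇒A out≡c in≡d = ≤-antisym
    (double-count-≤ e A B A⇒B (≤-reflexive ∘ sym ∘ out≡c) (≤-reflexive ∘ in≡d))
    (double-count-≤ (flip e) B A B⇒A (≤-reflexive ∘ sym ∘ in≡d) (≤-reflexive ∘ out≡c))

  module _ {R : Rel ℕ 0ℓ} (R-refl : Reflexive R) (R-trans : Transitive R)
           (R-*-mono : ∀ k {x y} → R x y → R (x * k) (y * k)) where

    open CommSemigroupProperties ℕ.*-commutativeSemigroup using (x∙yz≈xz∙y; xy∙z≈xz∙y)

    ratio-chain : ∀ {c d} i (a : ℕ → ℕ) → (∀ j → j < i → R (a j * c) (a (suc j) * d)) →
                  R (a 0 * c ^ i) (a i * d ^ i)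
    ratio-chain zero    a step = R-refl
    ratio-chain {c} {d} (suc i) a step =
      subst₂ R (sym (x∙yz≈xz∙y (a 0) c (c ^ i))) (ℕ.*-assoc (a (suc i)) d (d ^ i))
        (R-trans (subst (R _) (xy∙z≈xz∙y (a i) (d ^ i) c)
                    (R-*-mono c (ratio-chain i a (λ j j<i → step j (ℕ.m<n⇒m<1+n j<i)))))
                 (R-*-mono (d ^ i) (step i (n<1+n i))))

  module _ (G : Graph) where
    open Graph G

    ∈-layer⁻ : ∀ {j x} → x ∈ layer G j → level x ≡ j
    ∈-layer⁻ {j} {x} = toWitness {a? = level x ℕ.≟ j} ∘ ∈-tabulate⁻

    ∈-layer⁺ : ∀ {j x} → level x ≡ j → x ∈ layer G j
    ∈-layer⁺ = ∈-tabulate⁺ ∘ fromWitness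

    ∈-imⁱ-suc⁻ : ∀ {i Z y} → y ∈ imⁱ G (suc i) Z → ∃ λ x → x ∈ imⁱ G i Z × Edge G x y
    ∈-imⁱ-suc⁻ y∈ with satisfied (any⁻ _ (allFin N) (∈-tabulate⁻ y∈))
    ... | x , t with to T-∧ t
    ... | x∈ , xy = x , T-lookup⇒∈ x∈ , xy

    ∈-imⁱ-suc⁺ : ∀ {i Z x y} → x ∈ imⁱ G i Z → Edge G x y → y ∈ imⁱ G (suc i) Z
    ∈-imⁱ-suc⁺ {i} {Z} {y = y} x∈ xy = ∈-tabulate⁺ (any⁺ (λ x → lookup (imⁱ G i Z) x ∧ E x y)
                                                        (lose (∈-allFin _) (from T-∧ (∈⇒T-lookup x∈ , xy))))

  IsBiregular : Graph → ℕ → ℕ → ℕ → Set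
  IsBiregular G h c d = (∀ v → level v ≢ h → outdeg G v ≡ c) × (∀ v → level v ≢ 0 → indeg G v ≡ d)
    where open Graph G

  module Biregular {G : Graph} {h c d : ℕ} (layered : IsLayered G h) (biregular : IsBiregular G h c d) where
    open Graph G

    edge-level : ∀ {u v} → Edge G u v → level v ≡ suc (level u)
    edge-level = proj₂ layered _ _

    outdeg-below : ∀ {j u} → suc j ≤ h → level u ≡ j → outdeg G u ≡ c
    outdeg-below j<h refl = proj₁ biregular _ (<⇒≢ j<h)

    indeg-above : ∀ {j v} → level v ≡ suc j → indeg G v ≡ d
    indeg-above v∈ = proj₂ biregular _ (1+n≢0 ∘ trans (sym v∈))

    imⁱ-⊆-layer : ∀ i {Z} → Z ⊆ layer G 0 → imⁱ G i Z ⊆ layer G i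
    imⁱ-⊆-layer zero    Z⊆V₀ = Z⊆V₀
    imⁱ-⊆-layer (suc i) {Z} Z⊆V₀ y∈ with ∈-imⁱ-suc⁻ G {i} {Z} y∈
    ... | x , x∈ , xy =
      ∈-layer⁺ G (trans (edge-level xy) (cong suc (∈-layer⁻ G (imⁱ-⊆-layer i Z⊆V₀ x∈))))

    imⁱ-step : ∀ {i Z} → suc i ≤ h → Z ⊆ layer G 0 → ∣ imⁱ G i Z ∣ * c ≤ ∣ imⁱ G (suc i) Z ∣ * d
    imⁱ-step {i} {Z} i<h Z⊆V₀ = double-count-≤ E _ _ (∈-imⁱ-suc⁺ G {i} {Z})
      (≤-reflexive ∘ sym ∘ outdeg-below i<h ∘ ∈-layer⁻ G ∘ imⁱ-⊆-layer i Z⊆V₀)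
      (≤-reflexive ∘ indeg-above ∘ ∈-layer⁻ G ∘ imⁱ-⊆-layer (suc i) Z⊆V₀)

    layer-step : ∀ {j} → suc j ≤ h → ∣ layer G j ∣ * c ≡ ∣ layer G (suc j) ∣ * d
    layer-step j<h = double-count-≡ E _ _
      (λ u∈ uv → ∈-layer⁺ G (trans (edge-level uv) (cong suc (∈-layer⁻ G u∈))))
      (λ v∈ uv → ∈-layer⁺ G (suc-injective (trans (sym (edge-level uv)) (∈-layer⁻ G v∈))))
      (outdeg-below j<h ∘ ∈-layer⁻ G) (indeg-above ∘ ∈-layer⁻ G)

    layer-⊆-imⁱ : 1 ≤ d → ∀ i → layer G i ⊆ imⁱ G i (layer G 0)
    layer-⊆-imⁱ _   zero    = id
    layer-⊆-imⁱ 1≤d (suc i) {y} y∈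
      with ∣p∣≢0⇒nonempty (im⁻¹ G y) (λ indeg≡0 → <⇒≢ 1≤d (trans (sym indeg≡0) (indeg-above (∈-layer⁻ G y∈))))
    ... | x , x∈ = ∈-imⁱ-suc⁺ G {i} {layer G 0} (layer-⊆-imⁱ 1≤d i x∈Vᵢ) xy
      where
      xy : Edge G x y
      xy = ∈-tabulate⁻ x∈
      x∈Vᵢ : x ∈ layer G i
      x∈Vᵢ = ∈-layer⁺ G (suc-injective (trans (sym (edge-level xy)) (∈-layer⁻ G y∈)))

    imⁱ-layer₀≡layer : 1 ≤ d → ∀ i → imⁱ G i (layer G 0) ≡ layer G i
    imⁱ-layer₀≡layer 1≤d i = ⊆-antisym (imⁱ-⊆-layer i id) (layer-⊆-imⁱ 1≤d i)

    expansion : ∀ {i Z} → i ≤ h → Z ⊆ layer G 0 → ∣ Z ∣ * c ^ i ≤ ∣ imⁱ G i Z ∣ * d ^ i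
    expansion {i} i≤h Z⊆V₀ = ratio-chain {R = _≤_} ≤-refl ≤-trans *-monoˡ-≤ i (λ j → ∣ imⁱ G j _ ∣)
      (λ j j<i → imⁱ-step (<-≤-trans j<i i≤h) Z⊆V₀)

    layer-growth : ∀ {i} → i ≤ h → ∣ layer G 0 ∣ * c ^ i ≡ ∣ layer G i ∣ * d ^ i
    layer-growth {i} i≤h = ratio-chain {R = _≡_} refl trans (λ k → cong (_* k)) i (λ j → ∣ layer G j ∣)
      (λ j j<i → layer-step (<-≤-trans j<i i≤h))

  inverse-isBiregular : ∀ {G h c d} → IsBiregular G h c d → IsBiregular (inverse G h) h d c
  inverse-isBiregular {h = h} (outdeg≡c , indeg≡d) =
      (λ v ≢h → indeg≡d v (≢h ∘ cong (h ∸_)))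
    , (λ v ≢0 → outdeg≡c v (≢0 ∘ λ l≡h → trans (cong (h ∸_) l≡h) (n∸n≡0 h)))

open import Data.Rational using (_*_)

fromℚᵘ-homo-* : ∀ p q → ℚ.fromℚᵘ (p ℚᵘ.* q) ≡ ℚ.fromℚᵘ p * ℚ.fromℚᵘ q
fromℚᵘ-homo-* p q = toℚᵘ-injective (ℚᵘ.≃-trans (toℚᵘ-fromℚᵘ _)
  (ℚᵘ.≃-sym (ℚᵘ.≃-trans (toℚᵘ-homo-* (ℚ.fromℚᵘ p) (ℚ.fromℚᵘ q))
                       (ℚᵘ.*-cong (toℚᵘ-fromℚᵘ p) (toℚᵘ-fromℚᵘ q)))))

-- toℚ n is, by definition, ℚ.fromℚᵘ (ℚᵘ.mkℚᵘ (+ n) 0).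
toℚ-* : ∀ m n → toℚ (m ℕ.* n) ≡ toℚ m * toℚ n
toℚ-* m n = trans (cong (λ k → ℚ.fromℚᵘ (ℚᵘ.mkℚᵘ k 0)) (ℤ.pos-* m n))
                  (fromℚᵘ-homo-* (ℚᵘ.mkℚᵘ (+ m) 0) (ℚᵘ.mkℚᵘ (+ n) 0))

toℚᵘ-toℚ : ∀ n → ℚ.toℚᵘ (toℚ n) ℚᵘ.≃ ℚᵘ.mkℚᵘ (+ n) 0
toℚᵘ-toℚ n = toℚᵘ-fromℚᵘ (ℚᵘ.mkℚᵘ (+ n) 0)

toℚ-injective : ∀ {m n} → toℚ m ≡ toℚ n → m ≡ n
toℚ-injective {m} {n} eq
  with ℚᵘ.≃-trans (ℚᵘ.≃-sym (toℚᵘ-toℚ m)) (ℚᵘ.≃-trans (toℚᵘ-cong eq) (toℚᵘ-toℚ n))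
... | ℚᵘ.*≡* m*1≡n*1 = ℤ.+-injective (trans (sym (ℤ.*-identityʳ (+ m)))
                                            (trans m*1≡n*1 (ℤ.*-identityʳ (+ n))))

toℚ-mono-≤ : ∀ {m n} → m ≤ n → toℚ m ℚ.≤ toℚ n
toℚ-mono-≤ {m} {n} m≤n = toℚᵘ-cancel-≤
  (ℚᵘ.≤-respˡ-≃ (ℚᵘ.≃-sym (toℚᵘ-toℚ m)) (ℚᵘ.≤-respʳ-≃ (ℚᵘ.≃-sym (toℚᵘ-toℚ n))
    (ℚᵘ.*≤* (subst₂ ℤ._≤_ (sym (ℤ.*-identityʳ (+ m))) (sym (ℤ.*-identityʳ (+ n))) (ℤ.+≤+ m≤n)))))

toℚ-pos : ∀ n .{{_ : NonZero n}} → Positive (toℚ n)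
toℚ-pos (suc n) = normalize-pos (suc n) 1

-- A record rather than the bare equation, so that a and b are inferable from its type.
record IsRatio (q : ℚ) (a b : ℕ) : Set where
  constructor isRatio
  field toℚ-≡ : toℚ a ≡ q * toℚ b

open CommSemigroupProperties (CommutativeRing.*-commutativeSemigroup ℚ.+-*-commutativeRing)
  using (interchange; xy∙z≈xz∙y)

/-isRatio : ∀ m n .{{_ : NonZero n}} → IsRatio ((+ m) / n) m n
/-isRatio m (suc n) = isRatio (begin
  toℚ m                 ≡⟨ fromℚᵘ-cong {ℚᵘ.mkℚᵘ (+ m) 0} {m/n*n} (ℚᵘ.≃-sym (ℚᵘ.*≡* (begin
                             (+ m ℤ.* + suc n) ℤ.* + 1 ≡⟨ ℤ.*-identityʳ _ ⟩
                             + m ℤ.* + suc n           ≡⟨ cong (λ k → + m ℤ.* + suc k) (ℕ.*-identityʳ n) ⟨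
                             + m ℤ.* + suc (n ℕ.* 1)   ∎))) ⟩
  ℚ.fromℚᵘ m/n*n        ≡⟨ fromℚᵘ-homo-* (ℚᵘ.mkℚᵘ (+ m) n) (ℚᵘ.mkℚᵘ (+ suc n) 0) ⟩
  (+ m / suc n) * toℚ (suc n) ∎)
  where
  open ≡-Reasoning
  m/n*n = ℚᵘ.mkℚᵘ (+ m) n ℚᵘ.* ℚᵘ.mkℚᵘ (+ suc n) 0

ratio-≤ : ∀ {q r a b c d} .{{_ : NonZero b}} .{{_ : NonZero d}} →
          IsRatio q a b → IsRatio r c d → d ℕ.* a ≤ c ℕ.* b → q ℚ.≤ r
ratio-≤ {q} {r} {a} {b} {c} {d} (isRatio a≡qb) (isRatio c≡rd) da≤cb =
  *-cancelʳ-≤-pos (toℚ d) {{toℚ-pos d}} (*-cancelʳ-≤-pos (toℚ b) {{toℚ-pos b}} (begin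
    q * toℚ d * toℚ b ≡⟨ xy∙z≈xz∙y q (toℚ d) (toℚ b) ⟩
    q * toℚ b * toℚ d ≡⟨ cong (_* toℚ d) a≡qb ⟨
    toℚ a * toℚ d     ≡⟨ toℚ-* a d ⟨
    toℚ (a ℕ.* d)     ≤⟨ toℚ-mono-≤ (subst (_≤ c ℕ.* b) (ℕ.*-comm d a) da≤cb) ⟩
    toℚ (c ℕ.* b)     ≡⟨ toℚ-* c b ⟩
    toℚ c * toℚ b     ≡⟨ cong (_* toℚ b) c≡rd ⟩
    r * toℚ d * toℚ b ∎))
  where open ℚ.≤-Reasoning

ratio-≡ : ∀ {q r a b c d} .{{_ : NonZero b}} .{{_ : NonZero d}} →
          IsRatio q a b → IsRatio r c d → d ℕ.* a ≡ c ℕ.* b → q ≡ r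
ratio-≡ {a = a} {b} {c} {d} q≐a/b r≐c/d da≡cb = ℚ.≤-antisym
  (ratio-≤ q≐a/b r≐c/d (≤-reflexive da≡cb))
  (ratio-≤ r≐c/d q≐a/b (≤-reflexive (trans (ℕ.*-comm b c) (trans (sym da≡cb) (ℕ.*-comm d a)))))

isRatio-^ : ∀ {q a b} → IsRatio q a b → ∀ i → IsRatio (q ^ℚ i) (a ^ i) (b ^ i)
isRatio-^ _ zero = isRatio (sym (*-identityˡ _))
isRatio-^ {q} {a} {b} q≐a/b@(isRatio a≡qb) (suc i) = isRatio (begin
  toℚ (a ℕ.* a ^ i)                  ≡⟨ toℚ-* a (a ^ i) ⟩
  toℚ a * toℚ (a ^ i)                ≡⟨ cong₂ _*_ a≡qb (IsRatio.toℚ-≡ (isRatio-^ q≐a/b i)) ⟩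
  q * toℚ b * (q ^ℚ i * toℚ (b ^ i)) ≡⟨ interchange q (toℚ b) (q ^ℚ i) (toℚ (b ^ i)) ⟩
  q * q ^ℚ i * (toℚ b * toℚ (b ^ i)) ≡⟨ cong (q * q ^ℚ i *_) (toℚ-* b (b ^ i)) ⟨
  q * q ^ℚ i * toℚ (b ℕ.* b ^ i)     ∎)
  where open ≡-Reasoning

isRatio-1/ : ∀ {q a b} .{{_ : ℚ.NonZero q}} → IsRatio q a b → IsRatio (1/ q) b a
isRatio-1/ {q} {a} {b} (isRatio a≡qb) = isRatio (sym (begin
  (1/ q) * toℚ a       ≡⟨ cong ((1/ q) *_) a≡qb ⟩
  (1/ q) * (q * toℚ b) ≡⟨ ℚ.*-assoc (1/ q) q (toℚ b) ⟨
  (1/ q) * q * toℚ b   ≡⟨ cong (_* toℚ b) (*-inverseˡ q) ⟩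
  1ℚ * toℚ b           ≡⟨ *-identityˡ (toℚ b) ⟩
  toℚ b                ∎))
  where open ≡-Reasoning

isRatio⇒nonZero : ∀ {q a b} .{{_ : Positive q}} .{{_ : NonZero b}} → IsRatio q a b → NonZero a
isRatio⇒nonZero {a = suc a} _ = _
isRatio⇒nonZero {q} {zero} {b} (isRatio 0≡qb) =
  ⊥-elim (ℚ.<-irrefl 0≡qb (positive⁻¹ (q * toℚ b) {{pos*pos⇒pos q (toℚ b) {{toℚ-pos b}}}}))

module _ {G : Graph} {h c d : ℕ} {C : ℚ} (layered : IsLayered G h) (biregular : IsBiregular G h c d)
         (1≤d : 1 ≤ d) (C≐c/d : IsRatio C c d) {i : ℕ} (i≤h : i ≤ h) where

  open Biregular layered biregular

  private instance
    d≢0 : NonZero d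
    d≢0 = ℕ.>-nonZero 1≤d
    dⁱ≢0 : NonZero (d ^ i)
    dⁱ≢0 = m^n≢0 d i

  D-lower-bound : ∀ Z → Z ⊆ layer G 0 → (Z≢∅ : Nonempty Z) →
                  C ^ℚ i ℚ.≤ ((+ ∣ imⁱ G i Z ∣) / ∣ Z ∣) {{nonempty⇒nonZero Z Z≢∅}}
  D-lower-bound Z Z⊆V₀ Z≢∅ = ratio-≤ (isRatio-^ C≐c/d i) (/-isRatio ∣ imⁱ G i Z ∣ ∣ Z ∣) (expansion i≤h Z⊆V₀)
    where instance _ = nonempty⇒nonZero Z Z≢∅

  module _ (V₀≢∅ : Nonempty (layer G 0)) where

    private instance
      ∣V₀∣≢0 : NonZero ∣ layer G 0 ∣
      ∣V₀∣≢0 = nonempty⇒nonZero (layer G 0) V₀≢∅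

    D-attained : C ^ℚ i ≡ (+ ∣ imⁱ G i (layer G 0) ∣) / ∣ layer G 0 ∣
    D-attained = ratio-≡ (isRatio-^ C≐c/d i) (/-isRatio ∣ imⁱ G i (layer G 0) ∣ ∣ layer G 0 ∣)
      (trans (layer-growth i≤h) (cong (λ V → ∣ V ∣ ℕ.* d ^ i) (sym (imⁱ-layer₀≡layer 1≤d i))))

    D≡Cⁱ : D≡ G h i (C ^ℚ i)
    D≡Cⁱ = D-lower-bound , layer G 0 , id , V₀≢∅ , D-attained

    layer-isRatio : IsRatio (C ^ℚ i) ∣ layer G i ∣ ∣ layer G 0 ∣
    layer-isRatio = subst₂ (λ q V → IsRatio q ∣ V ∣ ∣ layer G 0 ∣) (sym D-attained) (imⁱ-layer₀≡layer 1≤d i)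
                           (/-isRatio ∣ imⁱ G i (layer G 0) ∣ ∣ layer G 0 ∣)

m∸n≡1+m∸1+n : ∀ {m n} → n < m → m ∸ n ≡ suc (m ∸ suc n)
m∸n≡1+m∸1+n {suc m} {zero}  _         = refl
m∸n≡1+m∸1+n {suc m} {suc n} (s≤s n<m) = m∸n≡1+m∸1+n n<m

inverse-isLayered : ∀ {G h} → IsLayered G h → IsLayered (inverse G h) h
inverse-isLayered {G} {h} (level≤h , edge-level) =
    (λ v → m∸n≤m h (level v))
  , (λ u v vu → trans (m∸n≡1+m∸1+n (subst (_≤ h) (edge-level v u vu) (level≤h u)))
                      (cong (λ l → suc (h ∸ l)) (sym (edge-level v u vu))))
  where open Graph G

inverse-isCommutative : ∀ {G} h → IsCommutative G → IsCommutative (inverse G h)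
inverse-isCommutative h (upward , downward) = (λ u v vu → downward v u vu) , (λ v w wv → upward w v wv)

isBiregular⇒isRegular : ∀ {G h c d C} → 1 ≤ d → IsRatio C c d → IsBiregular G h c d → IsRegular G h C
isBiregular⇒isRegular 1≤d (isRatio c≡Cd) (outdeg≡c , indeg≡d) =
  _ , 1≤d , indeg≡d , λ v ≢h → trans (cong toℚ (outdeg≡c v ≢h)) c≡Cd

lemma6 : (C : ℚ) (pos : Positive C) (h i : ℕ) → 1 ≤ i → i ≤ h →
    (G : Graph) → IsLayered G h → IsCommutative G → IsRegular G h C →
    Nonempty (layer G 0) →
    D≡ G h i (C ^ℚ i)
    × toℚ ∣ layer G i ∣ ≡ (C ^ℚ i) * toℚ ∣ layer G 0 ∣
    × (IsLayered (inverse G h) h × IsCommutative (inverse G h)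
       × IsRegular (inverse G h) h ((1/ C) {{pos⇒nonZero C {{pos}}}}))
lemma6 C pos h i 1≤i i≤h G layered commutative (d , 1≤d , indeg≡d , outdeg≡Cd) V₀≢∅@(v₀ , v₀∈V₀) =
    D≡Cⁱ layered biregular 1≤d C≐c/d i≤h V₀≢∅
  , IsRatio.toℚ-≡ (layer-isRatio layered biregular 1≤d C≐c/d i≤h V₀≢∅)
  , inverse-isLayered {G} layered
  , inverse-isCommutative {G} h commutative
  , isBiregular⇒isRegular (ℕ.>-nonZero⁻¹ c) (isRatio-1/ C≐c/d) (inverse-isBiregular biregular)
  where
  instance
    C>0 : Positive C
    C>0 = pos
    C≢0 : ℚ.NonZero C
    C≢0 = pos⇒nonZero C
    d≢0 : NonZero d
    d≢0 = ℕ.>-nonZero 1≤d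
  c : ℕ
  c = outdeg G v₀
  C≐c/d : IsRatio C c d
  C≐c/d = isRatio (outdeg≡Cd v₀ (<⇒≢ (≤-trans 1≤i i≤h) ∘ trans (sym (∈-layer⁻ G v₀∈V₀))))
  instance
    c≢0 : NonZero c
    c≢0 = isRatio⇒nonZero C≐c/d
  biregular : IsBiregular G h c d
  biregular = (λ v ≢h → toℚ-injective (trans (outdeg≡Cd v ≢h) (sym (IsRatio.toℚ-≡ C≐c/d)))) , indeg≡d
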